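{- Suppose that $\mathbb{C}$ is infinitary extensive. (1) For every relation $R\rightarrowtail X\times X$, $R^\star=\bigvee_{n\ge0}R^n$, where $R^0=\Delta_X$ and $R^n=R\cdot\cdots\cdot R$ ($n$ factors) for $n\ge1$. (2) For every non-empty family $\mathcal{R}$ of relations on $X$, $\bigl(\bigvee_{R\in\mathcal{R}}R\bigr)^\star=\bigvee_{n\ge0}\bigvee_{R_1,\dots,R_n\in\mathcal{R}}R_1\cdot\cdots\cdot R_n$ (the $n=0$ term being $\Delta_X$).
   Context: Standing assumptions: $\mathbb{C}$ is complete, has finite coproducts, is well-powered, monomorphisms are stable under finite coproducts, and strong epimorphisms are stable under pullback; every morphism has a (strong epi, mono)-factorization, whose mono part is its image. A relation on $X$ is a subobject $\langle l_R,r_R\rangle\colon R\rightarrowtail X\times X$; relations on $X$ form a complete lattice under $\le$ with joins $\bigvee$. $\Delta_X=\langle\mathrm{id},\mathrm{id}\rangle$. The composite $R\cdot S$ is the image of $\langle l_R\circ\bar l,r_S\circ\bar r\rangle$ where $(\bar l,\bar r)$ is the pullback of $r_R$ and $l_S$. $R^\star$ is the least relation containing $R$ that is reflexive ($\Delta\le R^\star$) and transitive ($R^\star\cdot R^\star\le R^\star$). Infinitary extensive: small coproducts exist and for every set-indexed family $(X_i)$ the functor $\prod_i\mathbb{C}/X_i\to\mathbb{C}/\coprod_iX_i$, $(p_i)\mapsto\coprod_ip_i$, is an equivalence. -}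

module Defs where

open import Level using (Level; _⊔_; Lift; lift; suc)
open import Data.Bool using (Bool; true; false)
open import Data.Nat using (ℕ; zero)
open import Data.Product using (Σ; Σ-syntax; _×_; _,_; proj₁; proj₂)
open import Data.Vec using (Vec; []; _∷_; replicate)
open import Relation.Binary.PropositionalEquality
  using (_≡_; refl; sym; trans; cong)

record Category (o h : Level) : Set (Level.suc (o ⊔ h)) where
  infixr 9 _∘_
  field
    Obj  : Set o
    Hom  : Obj → Obj → Set h
    id   : ∀ {A} → Hom A A
    _∘_  : ∀ {A B C} → Hom B C → Hom A B → Hom A C
    idˡ  : ∀ {A B} (f : Hom A B) → id ∘ f ≡ f
    idʳ  : ∀ {A B} (f : Hom A B) → f ∘ id ≡ f
    assoc : ∀ {A B C D} (f : Hom C D) (g : Hom B C) (k : Hom A B) →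
            (f ∘ g) ∘ k ≡ f ∘ (g ∘ k)

module CatNotions {o h : Level} (C : Category o h) where
  open Category C

  Mono : ∀ {A B} → Hom A B → Set (o ⊔ h)
  Mono {A} m = ∀ {Z} (f g : Hom Z A) → m ∘ f ≡ m ∘ g → f ≡ g

  Epi : ∀ {A B} → Hom A B → Set (o ⊔ h)
  Epi {B = B} e = ∀ {Z} (f g : Hom B Z) → f ∘ e ≡ g ∘ e → f ≡ g

  StrongEpi : ∀ {A B} → Hom A B → Set (o ⊔ h)
  StrongEpi {A} {B} e =
    Epi e ×
    (∀ {U V} (u : Hom A U) (v : Hom B V) (m : Hom U V) → Mono m →
       v ∘ e ≡ m ∘ u →
       Σ (Hom B U) λ d → (d ∘ e ≡ u) × (m ∘ d ≡ v) ×
         (∀ (d' : Hom B U) → d' ∘ e ≡ u → m ∘ d' ≡ v → d' ≡ d))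

  record Iso (A B : Obj) : Set h where
    field
      to   : Hom A B
      from : Hom B A
      from∘to : from ∘ to ≡ id
      to∘from : to ∘ from ≡ id

  IsPullback : ∀ {A B Z P} (f : Hom A Z) (g : Hom B Z)
               (p₁ : Hom P A) (p₂ : Hom P B) → Set (o ⊔ h)
  IsPullback {A} {B} {Z} {P} f g p₁ p₂ =
    (f ∘ p₁ ≡ g ∘ p₂) ×
    (∀ {Q} (q₁ : Hom Q A) (q₂ : Hom Q B) → f ∘ q₁ ≡ g ∘ q₂ →
       Σ (Hom Q P) λ u → (p₁ ∘ u ≡ q₁) × (p₂ ∘ u ≡ q₂) ×
         (∀ (u' : Hom Q P) → p₁ ∘ u' ≡ q₁ → p₂ ∘ u' ≡ q₂ → u' ≡ u))

record Setting (o h ι : Level) : Set (Level.suc (o ⊔ h ⊔ ι)) where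
  field
    cat : Category o h
  open Category cat public
  open CatNotions cat public
  field
    Π      : {I : Set ι} → (I → Obj) → Obj
    proj   : {I : Set ι} {X : I → Obj} (i : I) → Hom (Π X) (X i)
    tuple  : {I : Set ι} {X : I → Obj} {Z : Obj} → ((i : I) → Hom Z (X i)) → Hom Z (Π X)
    proj-tuple : {I : Set ι} {X : I → Obj} {Z : Obj} (f : (i : I) → Hom Z (X i))
                 (i : I) → proj i ∘ tuple f ≡ f i
    tuple-unique : {I : Set ι} {X : I → Obj} {Z : Obj} (f : (i : I) → Hom Z (X i))
                   (g : Hom Z (Π X)) → ((i : I) → proj i ∘ g ≡ f i) → g ≡ tuple f
    Eqz    : ∀ {A B} → Hom A B → Hom A B → Obj
    eqz    : ∀ {A B} (f g : Hom A B) → Hom (Eqz f g) A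
    eqz-eq : ∀ {A B} (f g : Hom A B) → f ∘ eqz f g ≡ g ∘ eqz f g
    eqz-univ : ∀ {A B Z} (f g : Hom A B) (k : Hom Z A) → f ∘ k ≡ g ∘ k →
               Σ (Hom Z (Eqz f g)) λ u → (eqz f g ∘ u ≡ k) ×
                 (∀ (u' : Hom Z (Eqz f g)) → eqz f g ∘ u' ≡ k → u' ≡ u)
    -- small coproducts (finite coproducts are the cases I = ⊥, Bool)
    ∐      : {I : Set ι} → (I → Obj) → Obj
    inj    : {I : Set ι} {X : I → Obj} (i : I) → Hom (X i) (∐ X)
    cotuple : {I : Set ι} {X : I → Obj} {Z : Obj} → ((i : I) → Hom (X i) Z) → Hom (∐ X) Z
    cotuple-inj : {I : Set ι} {X : I → Obj} {Z : Obj} (f : (i : I) → Hom (X i) Z)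
                  (i : I) → cotuple f ∘ inj i ≡ f i
    cotuple-unique : {I : Set ι} {X : I → Obj} {Z : Obj} (f : (i : I) → Hom (X i) Z)
                     (g : Hom (∐ X) Z) → ((i : I) → g ∘ inj i ≡ f i) → g ≡ cotuple f
    wellPowered : (X : Obj) →
      Σ (Set ι) λ S → Σ (S → Σ Obj λ A → Σ (Hom A X) Mono) λ sub →
        ∀ {A} (m : Hom A X) → Mono m →
          Σ S λ s → Σ (Iso A (proj₁ (sub s))) λ φ →
            proj₁ (proj₂ (sub s)) ∘ Iso.to φ ≡ m
    factor : ∀ {A B} (f : Hom A B) →
      Σ Obj λ M → Σ (Hom A M) λ e → Σ (Hom M B) λ m →
        StrongEpi e × Mono m × (m ∘ e ≡ f)
    strongEpi-pullback : ∀ {A B Z P} (f : Hom A Z) (g : Hom B Z)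
      (p₁ : Hom P A) (p₂ : Hom P B) → IsPullback f g p₁ p₂ →
      StrongEpi g → StrongEpi p₁


-- binary (co)products are Bool-indexed (co)products
two : ∀ {a ι} {Y : Set a} → Y → Y → Lift ι Bool → Y
two a b (lift true)  = a
two a b (lift false) = b

module Coprods {o h ι} (S : Setting o h ι) where
  open Setting S

  _⊕_ : ∀ {A B A' B'} → Hom A A' → Hom B B' →
        Hom (∐ (two {ι = ι} A B)) (∐ (two {ι = ι} A' B'))
  _⊕_ {A} {B} {A'} {B'} f g = cotuple {X = two A B} k
    where
    k : (i : Lift ι Bool) → Hom (two A B i) (∐ (two {ι = ι} A' B'))
    k (lift true)  = inj {X = two A' B'} (lift true) ∘ f
    k (lift false) = inj {X = two A' B'} (lift false) ∘ g

  ∐→ : {I : Set ι} {A B : I → Obj} → ((i : I) → Hom (A i) (B i)) → Hom (∐ A) (∐ B)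
  ∐→ {B = B} f = cotuple (λ i → inj {X = B} i ∘ f i)

-- monomorphisms are stable under finite coproducts
-- (the nullary case id : 0 → 0 is automatic)
MonoStableUnderFiniteCoproducts : ∀ {o h ι} → Setting o h ι → Set (o ⊔ h)
MonoStableUnderFiniteCoproducts S =
  ∀ {A B A' B'} (f : Hom A A') (g : Hom B B') →
  Mono f → Mono g → Mono (f ⊕ g)
  where open Setting S
        open Coprods S

-- Infinitary extensivity: for every small family (X i), the functor
--   Π_i C/X_i → C/∐_i X_i ,  (p_i) ↦ ∐_i p_i
-- is an equivalence (fully faithful and essentially surjective).

module Ext {o h ι} (S : Setting o h ι) where
  open Setting S
  open Coprods S

  Faithful : Set (o ⊔ h ⊔ Level.suc ι)
  Faithful = {I : Set ι} {X A B : I → Obj}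
    (p : (i : I) → Hom (A i) (X i)) (q : (i : I) → Hom (B i) (X i))
    (f f' : (i : I) → Hom (A i) (B i)) →
    ((i : I) → q i ∘ f i ≡ p i) → ((i : I) → q i ∘ f' i ≡ p i) →
    ∐→ f ≡ ∐→ f' → (i : I) → f i ≡ f' i

  Full : Set (o ⊔ h ⊔ Level.suc ι)
  Full = {I : Set ι} {X A B : I → Obj}
    (p : (i : I) → Hom (A i) (X i)) (q : (i : I) → Hom (B i) (X i))
    (g : Hom (∐ A) (∐ B)) → ∐→ q ∘ g ≡ ∐→ p →
    Σ ((i : I) → Hom (A i) (B i)) λ f →
      ((i : I) → q i ∘ f i ≡ p i) × (∐→ f ≡ g)

  EssSurj : Set (o ⊔ h ⊔ Level.suc ι)
  EssSurj = {I : Set ι} {X : I → Obj} {Y : Obj} (k : Hom Y (∐ X)) →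
    Σ (I → Obj) λ A → Σ ((i : I) → Hom (A i) (X i)) λ p →
      Σ (Iso Y (∐ A)) λ φ → ∐→ p ∘ Iso.to φ ≡ k

InfinitaryExtensive : ∀ {o h ι} → Setting o h ι → Set (o ⊔ h ⊔ Level.suc ι)
InfinitaryExtensive S = Full × Faithful × EssSurj
  where open Ext S

module Relations {o h ι} (S : Setting o h ι) where
  open Setting S

  _×ₒ_ : Obj → Obj → Obj
  A ×ₒ B = Π (two A B)

  ⟨_,_⟩ : ∀ {Z A B} → Hom Z A → Hom Z B → Hom Z (A ×ₒ B)
  ⟨_,_⟩ {A = A} {B} f g = tuple {X = two A B} k
    where
    k : (i : Lift ι Bool) → Hom _ (two A B i)
    k (lift true)  = f
    k (lift false) = g

  π₁ : ∀ {A B} → Hom (A ×ₒ B) A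
  π₁ {A} {B} = proj {X = two A B} (lift true)

  π₂ : ∀ {A B} → Hom (A ×ₒ B) B
  π₂ {A} {B} = proj {X = two A B} (lift false)

  record Rel (X : Obj) : Set (o ⊔ h) where
    constructor rel
    field
      carrier : Obj
      l r     : Hom carrier X
      mono    : Mono ⟨ l , r ⟩

  _≤_ : ∀ {X} → Rel X → Rel X → Set h
  R ≤ T = Σ (Hom (Rel.carrier R) (Rel.carrier T)) λ k →
            (Rel.l T ∘ k ≡ Rel.l R) × (Rel.r T ∘ k ≡ Rel.r R)

  _≅_ : ∀ {X} → Rel X → Rel X → Set h
  R ≅ T = (R ≤ T) × (T ≤ R)

  image : ∀ {X Z} → Hom Z (X ×ₒ X) → Rel X
  image f with factor f
  ... | M , e , m , _ , mono-m , _ =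
    record { carrier = M ; l = π₁ ∘ m ; r = π₂ ∘ m ; mono = mono' }
    where
    eqm : ⟨ π₁ ∘ m , π₂ ∘ m ⟩ ≡ m
    eqm = sym (tuple-unique _ m λ { (lift true) → refl ; (lift false) → refl })
    mono' : Mono ⟨ π₁ ∘ m , π₂ ∘ m ⟩
    mono' a b p rewrite eqm = mono-m a b p

  Δ : (X : Obj) → Rel X
  Δ X = record { carrier = X ; l = id ; r = id ; mono = m }
    where
    m : Mono ⟨ id , id ⟩
    m a b p =
      trans (sym (idˡ a))
      (trans (cong (_∘ a) (sym (proj-tuple _ (lift true))))
      (trans (assoc _ _ a)
      (trans (cong (π₁ ∘_) p)
      (trans (sym (assoc _ _ b))
      (trans (cong (_∘ b) (proj-tuple _ (lift true))) (idˡ b))))))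

  PB : ∀ {A B Z} → Hom A Z → Hom B Z → Obj
  PB f g = Eqz (f ∘ π₁) (g ∘ π₂)

  pb₁ : ∀ {A B Z} (f : Hom A Z) (g : Hom B Z) → Hom (PB f g) A
  pb₁ f g = π₁ ∘ eqz (f ∘ π₁) (g ∘ π₂)

  pb₂ : ∀ {A B Z} (f : Hom A Z) (g : Hom B Z) → Hom (PB f g) B
  pb₂ f g = π₂ ∘ eqz (f ∘ π₁) (g ∘ π₂)

  _·_ : ∀ {X} → Rel X → Rel X → Rel X
  R · T = image ⟨ Rel.l R ∘ pb₁ (Rel.r R) (Rel.l T) ,
                  Rel.r T ∘ pb₂ (Rel.r R) (Rel.l T) ⟩

  comp : ∀ {X n} → Vec (Rel X) n → Rel X
  comp {X} []           = Δ X
  comp     (R ∷ [])     = R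
  comp     (R ∷ T ∷ Rs) = R · comp (T ∷ Rs)

  pow : ∀ {X} → Rel X → ℕ → Rel X
  pow R n = comp (replicate n R)

  IsJoin : ∀ {X ℓ} → (Rel X → Set ℓ) → Rel X → Set (o ⊔ h ⊔ ℓ)
  IsJoin P T = (∀ R → P R → R ≤ T) ×
               (∀ U → (∀ R → P R → R ≤ U) → T ≤ U)

  IsReflTransClosure : ∀ {X} → Rel X → Rel X → Set (o ⊔ h)
  IsReflTransClosure {X} R T =
    (R ≤ T) × (Δ X ≤ T) × ((T · T) ≤ T) ×
    (∀ U → R ≤ U → Δ X ≤ U → (U · U) ≤ U → T ≤ U)

{-# OPTIONS --safe #-}
-- Work with generalized elements: for a, b : Z → X, a ∼[ W ] b says that ⟨ a , b ⟩ factors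
-- through W. This is stable under precomposition and, W being a subobject, descends along
-- strong epimorphisms; so a ∼[ R · T ] c holds iff, locally on a strong-epi cover of Z, some
-- b has a ∼[ R ] b and b ∼[ T ] c. Extensivity supplies the key fact: a generalized element
-- of a small join ⋁ Aᵢ lies, locally on a strong-epi cover followed by a coproduct
-- decomposition, in a single Aᵢ. Hence composition distributes over small joins, and
-- U = ⋁ₙ ⋁ R₁ ⋯ Rₙ is closed under composition. Being reflexive and containing every Rᵢ,
-- U contains the reflexive-transitive closure; conversely every R₁ ⋯ Rₙ lies in the closure.
-- Statement (1) is the case of a one-element family.
module Submission where

open import Defs
open import Level using (Level; _⊔_; Lift; lift; lower)
open import Data.Bool using (true; false)
open import Data.Nat using (ℕ)
open import Data.Product using (Σ; _×_; _,_; proj₁; proj₂)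
open import Data.Unit using (⊤; tt)
open import Data.Vec using (Vec; []; _∷_; _++_; map; replicate)
open import Data.Vec.Properties using (map-++; map-const)
open import Relation.Binary.PropositionalEquality
  using (_≡_; refl; sym; trans; cong; cong₂; subst; subst₂; module ≡-Reasoning)

module RelationCalculus {o h ι : Level} (S : Setting o h ι) where
  open Setting S
  open Relations S
  open Coprods S using (∐→)
  open ≡-Reasoning

  pullˡ : ∀ {A B C D} {f : Hom C D} {g : Hom B C} {fg : Hom B D} (k : Hom A B) →
          f ∘ g ≡ fg → f ∘ (g ∘ k) ≡ fg ∘ k
  pullˡ {f = f} {g} k p = trans (sym (assoc f g k)) (cong (_∘ k) p)

  π₁∘⟨⟩ : ∀ {Z A B} (f : Hom Z A) (g : Hom Z B) → π₁ ∘ ⟨ f , g ⟩ ≡ f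
  π₁∘⟨⟩ {A = A} {B} f g = proj-tuple {X = two A B} _ (lift true)

  π₂∘⟨⟩ : ∀ {Z A B} (f : Hom Z A) (g : Hom Z B) → π₂ ∘ ⟨ f , g ⟩ ≡ g
  π₂∘⟨⟩ {A = A} {B} f g = proj-tuple {X = two A B} _ (lift false)

  π-ext : ∀ {Z A B} {u v : Hom Z (A ×ₒ B)} → π₁ ∘ u ≡ π₁ ∘ v → π₂ ∘ u ≡ π₂ ∘ v → u ≡ v
  π-ext {A = A} {B} {u} {v} p q =
    trans (tuple-unique {X = two A B} (λ i → proj i ∘ v) u
             (λ { (lift true) → p ; (lift false) → q }))
          (sym (tuple-unique {X = two A B} (λ i → proj i ∘ v) v (λ _ → refl)))

  ⟨⟩∘ : ∀ {Y Z A B} (f : Hom Z A) (g : Hom Z B) (k : Hom Y Z) →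
        ⟨ f , g ⟩ ∘ k ≡ ⟨ f ∘ k , g ∘ k ⟩
  ⟨⟩∘ f g k = π-ext (trans (pullˡ k (π₁∘⟨⟩ f g)) (sym (π₁∘⟨⟩ _ _)))
                    (trans (pullˡ k (π₂∘⟨⟩ f g)) (sym (π₂∘⟨⟩ _ _)))

  ⟨⟩-injective : ∀ {Z A B} {f f' : Hom Z A} {g g' : Hom Z B} →
                 ⟨ f , g ⟩ ≡ ⟨ f' , g' ⟩ → (f ≡ f') × (g ≡ g')
  ⟨⟩-injective {f = f} {f'} {g} {g'} p =
    trans (sym (π₁∘⟨⟩ f g)) (trans (cong (π₁ ∘_) p) (π₁∘⟨⟩ f' g')) ,
    trans (sym (π₂∘⟨⟩ f g)) (trans (cong (π₂ ∘_) p) (π₂∘⟨⟩ f' g'))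

  ∐-ext : ∀ {I : Set ι} {E : I → Obj} {Z} {u v : Hom (∐ E) Z} →
          (∀ i → u ∘ inj i ≡ v ∘ inj i) → u ≡ v
  ∐-ext {u = u} {v} p = trans (cotuple-unique _ u p) (sym (cotuple-unique _ v (λ _ → refl)))

  PB-isPullback : ∀ {A B Z} (f : Hom A Z) (g : Hom B Z) → IsPullback f g (pb₁ f g) (pb₂ f g)
  PB-isPullback f g = square , universal
    where
    e = eqz (f ∘ π₁) (g ∘ π₂)

    square : f ∘ (π₁ ∘ e) ≡ g ∘ (π₂ ∘ e)
    square = begin
      f ∘ (π₁ ∘ e)   ≡⟨ sym (assoc f π₁ e) ⟩
      (f ∘ π₁) ∘ e   ≡⟨ eqz-eq (f ∘ π₁) (g ∘ π₂) ⟩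
      (g ∘ π₂) ∘ e   ≡⟨ assoc g π₂ e ⟩
      g ∘ (π₂ ∘ e)   ∎

    universal : ∀ {Q} (q₁ : Hom Q _) (q₂ : Hom Q _) → f ∘ q₁ ≡ g ∘ q₂ →
      Σ (Hom Q (PB f g)) λ u → ((π₁ ∘ e) ∘ u ≡ q₁) × ((π₂ ∘ e) ∘ u ≡ q₂) ×
        (∀ u' → (π₁ ∘ e) ∘ u' ≡ q₁ → (π₂ ∘ e) ∘ u' ≡ q₂ → u' ≡ u)
    universal {Q} q₁ q₂ sq =
      u , legs (π₁∘⟨⟩ q₁ q₂) , legs (π₂∘⟨⟩ q₁ q₂) ,
      λ u' p₁ p₂ → u-unique u' (π-ext (trans (sym (assoc π₁ e u')) (trans p₁ (sym (π₁∘⟨⟩ q₁ q₂))))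
                                      (trans (sym (assoc π₂ e u')) (trans p₂ (sym (π₂∘⟨⟩ q₁ q₂)))))
      where
      q = ⟨ q₁ , q₂ ⟩
      equalized : (f ∘ π₁) ∘ q ≡ (g ∘ π₂) ∘ q
      equalized = begin
        (f ∘ π₁) ∘ q   ≡⟨ assoc f π₁ q ⟩
        f ∘ (π₁ ∘ q)   ≡⟨ cong (f ∘_) (π₁∘⟨⟩ q₁ q₂) ⟩
        f ∘ q₁         ≡⟨ sq ⟩
        g ∘ q₂         ≡⟨ cong (g ∘_) (sym (π₂∘⟨⟩ q₁ q₂)) ⟩
        g ∘ (π₂ ∘ q)   ≡⟨ sym (assoc g π₂ q) ⟩
        (g ∘ π₂) ∘ q   ∎
      mediating = eqz-univ (f ∘ π₁) (g ∘ π₂) q equalized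
      u = proj₁ mediating
      u-unique = proj₂ (proj₂ mediating)
      legs : ∀ {C} {p : Hom _ C} {qᵢ : Hom Q C} → p ∘ q ≡ qᵢ → (p ∘ e) ∘ u ≡ qᵢ
      legs {p = p} pq = trans (assoc p e u) (trans (cong (p ∘_) (proj₁ (proj₂ mediating))) pq)

  pb-square : ∀ {A B Z} (f : Hom A Z) (g : Hom B Z) → f ∘ pb₁ f g ≡ g ∘ pb₂ f g
  pb-square f g = proj₁ (PB-isPullback f g)

  infix 4 _∼[_]_ _⊆_

  record _∼[_]_ {X Z : Obj} (a : Hom Z X) (W : Rel X) (b : Hom Z X) : Set h where
    constructor via
    field
      element : Hom Z (Rel.carrier W)
      l∘element : Rel.l W ∘ element ≡ a
      r∘element : Rel.r W ∘ element ≡ b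

  -- The order _≤_ as a record, so that Agda can infer the relations involved.
  record _⊆_ {X : Obj} (R T : Rel X) : Set h where
    constructor ⊆-intro
    field generic : Rel.l R ∼[ T ] Rel.r R

  module _ {X : Obj} where

    ⊆⇒≤ : {R T : Rel X} → R ⊆ T → R ≤ T
    ⊆⇒≤ (⊆-intro (via k kl kr)) = k , kl , kr

    ≤⇒⊆ : {R T : Rel X} → R ≤ T → R ⊆ T
    ≤⇒⊆ (k , kl , kr) = ⊆-intro (via k kl kr)

    ∼-cong : ∀ {Z} {W : Rel X} {a a' b b' : Hom Z X} → a ≡ a' → b ≡ b' → a ∼[ W ] b → a' ∼[ W ] b'
    ∼-cong {W = W} = subst₂ (_∼[ W ]_)

    ∼-member : ∀ {Z} {W : Rel X} (g : Hom Z (Rel.carrier W)) → Rel.l W ∘ g ∼[ W ] Rel.r W ∘ g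
    ∼-member g = via g refl refl

    ∼-∘ : ∀ {Z Q} {W : Rel X} {a b : Hom Z X} → a ∼[ W ] b → (z : Hom Q Z) → a ∘ z ∼[ W ] b ∘ z
    ∼-∘ (via g ga gb) z = via (g ∘ z) (pullˡ z ga) (pullˡ z gb)

    ∼-⊆ : ∀ {Z} {W V : Rel X} {a b : Hom Z X} → W ⊆ V → a ∼[ W ] b → a ∼[ V ] b
    ∼-⊆ (⊆-intro (via k kl kr)) (via g ga gb) =
      via (k ∘ g) (trans (pullˡ g kl) ga) (trans (pullˡ g kr) gb)

    ⊆-refl : {R : Rel X} → R ⊆ R
    ⊆-refl = ⊆-intro (via id (idʳ _) (idʳ _))

    ⊆-trans : {R T V : Rel X} → R ⊆ T → T ⊆ V → R ⊆ V
    ⊆-trans (⊆-intro R∼T) T⊆V = ⊆-intro (∼-⊆ T⊆V R∼T)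

    ∼-descent : ∀ {Z Z'} {W : Rel X} {s : Hom Z' Z} {a b : Hom Z X} →
                StrongEpi s → a ∘ s ∼[ W ] b ∘ s → a ∼[ W ] b
    ∼-descent {W = W} {s} {a} {b} (_ , diagonal) (via g ga gb) =
      via (proj₁ fill) (proj₁ (⟨⟩-injective ⟨l,r⟩∘fill)) (proj₂ (⟨⟩-injective ⟨l,r⟩∘fill))
      where
      square : ⟨ a , b ⟩ ∘ s ≡ ⟨ Rel.l W , Rel.r W ⟩ ∘ g
      square = begin
        ⟨ a , b ⟩ ∘ s                 ≡⟨ ⟨⟩∘ a b s ⟩
        ⟨ a ∘ s , b ∘ s ⟩             ≡⟨ cong₂ ⟨_,_⟩ (sym ga) (sym gb) ⟩
        ⟨ Rel.l W ∘ g , Rel.r W ∘ g ⟩ ≡⟨ sym (⟨⟩∘ _ _ g) ⟩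
        ⟨ Rel.l W , Rel.r W ⟩ ∘ g     ∎
      fill = diagonal g ⟨ a , b ⟩ ⟨ Rel.l W , Rel.r W ⟩ (Rel.mono W) square
      ⟨l,r⟩∘fill : ⟨ Rel.l W ∘ proj₁ fill , Rel.r W ∘ proj₁ fill ⟩ ≡ ⟨ a , b ⟩
      ⟨l,r⟩∘fill = trans (sym (⟨⟩∘ _ _ _)) (proj₁ (proj₂ (proj₂ fill)))

    ∼-cotuple : ∀ {I : Set ι} {E : I → Obj} {W : Rel X} {a b : Hom (∐ E) X} →
                (∀ i → a ∘ inj i ∼[ W ] b ∘ inj i) → a ∼[ W ] b
    ∼-cotuple {W = W} pieces =
      via (cotuple g) (∐-ext (λ i → glue i (_∼[_]_.l∘element (pieces i))))
                      (∐-ext (λ i → glue i (_∼[_]_.r∘element (pieces i))))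
      where
      g = λ i → _∼[_]_.element (pieces i)
      glue : ∀ {t c} i → t ∘ g i ≡ c ∘ inj i → (t ∘ cotuple g) ∘ inj i ≡ c ∘ inj i
      glue {t} i tg = trans (assoc t _ _) (trans (cong (t ∘_) (cotuple-inj g i)) tg)

    Δ-elim : ∀ {Z} {a b : Hom Z X} → a ∼[ Δ X ] b → a ≡ b
    Δ-elim (via g ga gb) = trans (sym ga) gb

  module _ {X : Obj} where

    image-cover : ∀ {Z} (f : Hom Z (X ×ₒ X)) →
      Σ (Hom Z (Rel.carrier (image f))) λ e → StrongEpi e ×
        (Rel.l (image f) ∘ e ≡ π₁ ∘ f) × (Rel.r (image f) ∘ e ≡ π₂ ∘ f)
    image-cover f with factor f
    ... | _ , e , m , e-strong , _ , m∘e≡f =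
      e , e-strong , trans (assoc π₁ m e) (cong (π₁ ∘_) m∘e≡f) ,
                     trans (assoc π₂ m e) (cong (π₂ ∘_) m∘e≡f)

    image-intro : ∀ {Z} (f : Hom Z (X ×ₒ X)) → π₁ ∘ f ∼[ image f ] π₂ ∘ f
    image-intro f with image-cover f
    ... | e , _ , le , re = via e le re

    image-least : ∀ {Z} {f : Hom Z (X ×ₒ X)} {W : Rel X} → π₁ ∘ f ∼[ W ] π₂ ∘ f → image f ⊆ W
    image-least {f = f} f∼ with image-cover f
    ... | e , e-strong , le , re = ⊆-intro (∼-descent e-strong (∼-cong (sym le) (sym re) f∼))

    image-elim : ∀ {Y Z D} {f : Hom D (X ×ₒ X)} {a b : Hom Z X} {W : Rel Y} {c d : Hom Z Y} →
      a ∼[ image f ] b →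
      (∀ {Q} (s : Hom Q Z) (z : Hom Q D) → (π₁ ∘ f) ∘ z ≡ a ∘ s → (π₂ ∘ f) ∘ z ≡ b ∘ s →
         c ∘ s ∼[ W ] d ∘ s) →
      c ∼[ W ] d
    image-elim {f = f} (via g ga gb) k with image-cover f
    ... | e , e-strong , le , re = ∼-descent p₁-strong (k p₁ p₂ (over le ga) (over re gb))
      where
      p₁ = pb₁ g e
      p₂ = pb₂ g e
      p₁-strong : StrongEpi p₁
      p₁-strong = strongEpi-pullback g e p₁ p₂ (PB-isPullback g e) e-strong
      over : ∀ {t u a'} → t ∘ e ≡ u → t ∘ g ≡ a' → u ∘ p₂ ≡ a' ∘ p₁
      over {t} {u} {a'} te tg = begin
        u ∘ p₂        ≡⟨ cong (_∘ p₂) (sym te) ⟩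
        (t ∘ e) ∘ p₂  ≡⟨ assoc t e p₂ ⟩
        t ∘ (e ∘ p₂)  ≡⟨ cong (t ∘_) (sym (pb-square g e)) ⟩
        t ∘ (g ∘ p₁)  ≡⟨ pullˡ p₁ tg ⟩
        a' ∘ p₁       ∎

    ·-span : (R T : Rel X) → Hom (PB (Rel.r R) (Rel.l T)) (X ×ₒ X)
    ·-span R T = ⟨ Rel.l R ∘ pb₁ (Rel.r R) (Rel.l T) , Rel.r T ∘ pb₂ (Rel.r R) (Rel.l T) ⟩

    ·-span₁ : ∀ {Q} (R T : Rel X) (z : Hom Q (PB (Rel.r R) (Rel.l T))) →
              (π₁ ∘ ·-span R T) ∘ z ≡ Rel.l R ∘ (pb₁ (Rel.r R) (Rel.l T) ∘ z)
    ·-span₁ R T z = trans (cong (_∘ z) (π₁∘⟨⟩ _ _)) (assoc _ _ z)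

    ·-span₂ : ∀ {Q} (R T : Rel X) (z : Hom Q (PB (Rel.r R) (Rel.l T))) →
              (π₂ ∘ ·-span R T) ∘ z ≡ Rel.r T ∘ (pb₂ (Rel.r R) (Rel.l T) ∘ z)
    ·-span₂ R T z = trans (cong (_∘ z) (π₂∘⟨⟩ _ _)) (assoc _ _ z)

    ·-intro : ∀ {Z} {R T : Rel X} {a b c : Hom Z X} → a ∼[ R ] b → b ∼[ T ] c → a ∼[ R · T ] c
    ·-intro {R = R} {T} (via x xa xb) (via y yb yc) =
      ∼-cong (trans (·-span₁ R T u) (trans (cong (Rel.l R ∘_) pb₁∘u) xa))
             (trans (·-span₂ R T u) (trans (cong (Rel.r T ∘_) pb₂∘u) yc))
             (∼-∘ (image-intro (·-span R T)) u)
      where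
      pairing = proj₂ (PB-isPullback (Rel.r R) (Rel.l T)) x y (trans xb (sym yb))
      u = proj₁ pairing
      pb₁∘u = proj₁ (proj₂ pairing)
      pb₂∘u = proj₁ (proj₂ (proj₂ pairing))

    ·-least : {R T W : Rel X} →
      (∀ {Z} {a b c : Hom Z X} → a ∼[ R ] b → b ∼[ T ] c → a ∼[ W ] c) → R · T ⊆ W
    ·-least {R} {T} compose =
      image-least (∼-cong (sym (π₁∘⟨⟩ _ _)) (sym (π₂∘⟨⟩ _ _))
        (compose (∼-member (pb₁ (Rel.r R) (Rel.l T)))
                 (∼-cong (sym (pb-square (Rel.r R) (Rel.l T))) refl
                         (∼-member (pb₂ (Rel.r R) (Rel.l T))))))

    ·-elim : ∀ {Y Z} {R T : Rel X} {a c : Hom Z X} {W : Rel Y} {u v : Hom Z Y} →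
      a ∼[ R · T ] c →
      (∀ {Q} (s : Hom Q Z) {b : Hom Q X} → a ∘ s ∼[ R ] b → b ∼[ T ] c ∘ s → u ∘ s ∼[ W ] v ∘ s) →
      u ∼[ W ] v
    ·-elim {R = R} {T} a∼c k = image-elim a∼c λ s z as cs →
      k s (via (p₁ ∘ z) (trans (sym (·-span₁ R T z)) as) refl)
          (via (p₂ ∘ z) (trans (pullˡ z (sym (pb-square (Rel.r R) (Rel.l T)))) (assoc _ p₁ z))
                        (trans (sym (·-span₂ R T z)) cs))
      where
      p₁ = pb₁ (Rel.r R) (Rel.l T)
      p₂ = pb₂ (Rel.r R) (Rel.l T)

    ·-mono : {R R' T T' : Rel X} → R ⊆ R' → T ⊆ T' → R · T ⊆ R' · T'
    ·-mono R⊆R' T⊆T' = ·-least λ a∼b b∼c → ·-intro (∼-⊆ R⊆R' a∼b) (∼-⊆ T⊆T' b∼c)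

    Δ·R⊆R : {R : Rel X} → Δ X · R ⊆ R
    Δ·R⊆R = ·-least λ a∼b b∼c → ∼-cong (sym (Δ-elim a∼b)) refl b∼c

    R·Δ⊆R : {R : Rel X} → R · Δ X ⊆ R
    R·Δ⊆R = ·-least λ a∼b b∼c → ∼-cong refl (Δ-elim b∼c) a∼b

    ·-assoc : (A B C : Rel X) → (A · B) · C ⊆ A · (B · C)
    ·-assoc A B C = ·-least {A · B} {C} λ a∼b b∼c →
      ·-elim {R = A} {B} a∼b λ s as∼b' b'∼bs → ·-intro as∼b' (·-intro b'∼bs (∼-∘ b∼c s))

    comp-++ : ∀ {m n} (Rs : Vec (Rel X) m) (Ts : Vec (Rel X) n) → comp Rs · comp Ts ⊆ comp (Rs ++ Ts)
    comp-++ []            Ts       = Δ·R⊆R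
    comp-++ (R ∷ [])      []       = R·Δ⊆R
    comp-++ (R ∷ [])      (T ∷ Ts) = ⊆-refl
    comp-++ (R ∷ R' ∷ Rs) Ts       =
      ⊆-trans (·-assoc R (comp (R' ∷ Rs)) (comp Ts))
              (·-mono (⊆-refl {R = R}) (comp-++ (R' ∷ Rs) Ts))

    comp-map-++ : ∀ {a m n} {A : Set a} (F : A → Rel X) (is : Vec A m) (js : Vec A n) →
                  comp (map F is) · comp (map F js) ⊆ comp (map F (is ++ js))
    comp-map-++ F is js rewrite map-++ F is js = comp-++ (map F is) (map F js)

    comp-map-⊆ : ∀ {a} {A : Set a} {F : A → Rel X} {T : Rel X} → Δ X ⊆ T → T · T ⊆ T →
                 (∀ i → F i ⊆ T) → ∀ {n} (is : Vec A n) → comp (map F is) ⊆ T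
    comp-map-⊆ Δ⊆T TT⊆T F⊆T []           = Δ⊆T
    comp-map-⊆ Δ⊆T TT⊆T F⊆T (i ∷ [])     = F⊆T i
    comp-map-⊆ Δ⊆T TT⊆T F⊆T (i ∷ j ∷ is) =
      ⊆-trans (·-mono (F⊆T i) (comp-map-⊆ Δ⊆T TT⊆T F⊆T (j ∷ is))) TT⊆T

  record Join {ℓ X} {K : Set ℓ} (A : K → Rel X) (U : Rel X) : Set (o ⊔ h ⊔ ℓ) where
    field
      upper : ∀ k → A k ⊆ U
      least : ∀ V → (∀ k → A k ⊆ V) → U ⊆ V

  join : ∀ {ℓ X} {K : Set ℓ} {A : K → Rel X} {U : Rel X} →
         IsJoin (λ P → Σ K λ k → P ≡ A k) U → Join A U
  join (upper , least) = record
    { upper = λ k → ≤⇒⊆ (upper _ (k , refl))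
    ; least = λ V A⊆V → ≤⇒⊆ (least V λ { _ (k , refl) → ⊆⇒≤ (A⊆V k) })
    }

  _≤⋁_ : ∀ {X} {I : Set ι} → Rel X → (I → Rel X) → Set (o ⊔ h ⊔ ι)
  U ≤⋁ A = ∀ V → (∀ i → A i ⊆ V) → U ⊆ V

  module Extensive (essSurj : Ext.EssSurj S) where

    ∼-coproduct-local : ∀ {X Z} {I : Set ι} {E : I → Obj} (k : Hom Z (∐ E))
                          {W : Rel X} {c d : Hom Z X} →
      (∀ i {Q} (y : Hom Q (E i)) (w : Hom Q Z) → inj i ∘ y ≡ k ∘ w → c ∘ w ∼[ W ] d ∘ w) →
      c ∼[ W ] d
    ∼-coproduct-local {E = E} k {c = c} {d} local with essSurj {X = E} k
    ... | _ , p , φ , ∐p∘to≡k = ∼-cong (cancel c) (cancel d) (∼-∘ (∼-cotuple pieces) to)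
      where
      open Iso φ
      k∘from : k ∘ from ≡ ∐→ p
      k∘from = begin
        k ∘ from               ≡⟨ cong (_∘ from) (sym ∐p∘to≡k) ⟩
        (∐→ p ∘ to) ∘ from     ≡⟨ assoc _ to from ⟩
        ∐→ p ∘ (to ∘ from)     ≡⟨ cong (∐→ p ∘_) to∘from ⟩
        ∐→ p ∘ id              ≡⟨ idʳ _ ⟩
        ∐→ p                   ∎
      lies-over : ∀ i → inj i ∘ p i ≡ k ∘ (from ∘ inj i)
      lies-over i = begin
        inj i ∘ p i            ≡⟨ sym (cotuple-inj _ i) ⟩
        ∐→ p ∘ inj i           ≡⟨ cong (_∘ inj i) (sym k∘from) ⟩
        (k ∘ from) ∘ inj i     ≡⟨ assoc k from (inj i) ⟩
        k ∘ (from ∘ inj i)     ∎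
      pieces : ∀ i → (c ∘ from) ∘ inj i ∼[ _ ] (d ∘ from) ∘ inj i
      pieces i = ∼-cong (sym (assoc c from _)) (sym (assoc d from _))
                        (local i (p i) (from ∘ inj i) (lies-over i))
      cancel : ∀ t → (t ∘ from) ∘ to ≡ t
      cancel t = trans (assoc t from to) (trans (cong (t ∘_) from∘to) (idʳ t))

    join-elim : ∀ {X Y Z} {I : Set ι} (A : I → Rel X) {U : Rel X} → U ≤⋁ A →
      {a b : Hom Z X} {W : Rel Y} {c d : Hom Z Y} → a ∼[ U ] b →
      (∀ i {Q} (z : Hom Q Z) → a ∘ z ∼[ A i ] b ∘ z → c ∘ z ∼[ W ] d ∘ z) →
      c ∼[ W ] d
    -- The image of ∐ᵢ Aᵢ → X × X bounds every Aᵢ, so it contains U, and its generalized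
    -- elements come, after a strong-epi cover, from the coproduct and hence from the summands.
    join-elim {X} {Z = Z} A U≤⋁A {c = c} {d} a∼b local =
      image-elim (∼-⊆ (U≤⋁A (image pairs) A⊆image) a∼b) λ s z as bs →
        ∼-coproduct-local z λ i y w iy≡zw →
          ∼-cong (sym (assoc c s w)) (sym (assoc d s w))
            (local i (s ∘ w) (via y (over (π₁∘⟨⟩ _ _) iy≡zw as) (over (π₂∘⟨⟩ _ _) iy≡zw bs)))
      where
      E = λ i → Rel.carrier (A i)
      pairs : Hom (∐ E) (X ×ₒ X)
      pairs = cotuple λ i → ⟨ Rel.l (A i) , Rel.r (A i) ⟩
      on-summand : ∀ {i} (p : Hom (X ×ₒ X) X) →
                   (p ∘ pairs) ∘ inj i ≡ p ∘ ⟨ Rel.l (A i) , Rel.r (A i) ⟩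
      on-summand p = trans (assoc p pairs _) (cong (p ∘_) (cotuple-inj _ _))
      A⊆image : ∀ i → A i ⊆ image pairs
      A⊆image i = ⊆-intro (∼-cong (trans (on-summand π₁) (π₁∘⟨⟩ _ _))
                                  (trans (on-summand π₂) (π₂∘⟨⟩ _ _))
                                  (∼-∘ (image-intro pairs) (inj i)))
      over : ∀ {i Q Q'} {p : Hom (X ×ₒ X) X} {t : Hom (E i) X} {s : Hom Q Z} {z : Hom Q (∐ E)}
               {y : Hom Q' (E i)} {w : Hom Q' Q} {a' : Hom Z X} →
             p ∘ ⟨ Rel.l (A i) , Rel.r (A i) ⟩ ≡ t → inj i ∘ y ≡ z ∘ w →
             (p ∘ pairs) ∘ z ≡ a' ∘ s → t ∘ y ≡ a' ∘ (s ∘ w)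
      over {i} {p = p} {t} {s} {z} {y} {w} {a'} pt iy≡zw ps = begin
        t ∘ y                       ≡⟨ cong (_∘ y) (sym (trans (on-summand p) pt)) ⟩
        ((p ∘ pairs) ∘ inj i) ∘ y   ≡⟨ assoc _ (inj i) y ⟩
        (p ∘ pairs) ∘ (inj i ∘ y)   ≡⟨ cong ((p ∘ pairs) ∘_) iy≡zw ⟩
        (p ∘ pairs) ∘ (z ∘ w)       ≡⟨ sym (assoc _ z w) ⟩
        ((p ∘ pairs) ∘ z) ∘ w       ≡⟨ cong (_∘ w) ps ⟩
        (a' ∘ s) ∘ w                ≡⟨ assoc a' s w ⟩
        a' ∘ (s ∘ w)                ∎

    ·-join : ∀ {X} {I I' : Set ι} {A : I → Rel X} {B : I' → Rel X} {U V W : Rel X} →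
      U ≤⋁ A → V ≤⋁ B → (∀ i j → A i · B j ⊆ W) → U · V ⊆ W
    ·-join {A = A} {B} {U} {V} U≤⋁A V≤⋁B AB⊆W = ·-least {R = U} {T = V} λ a∼b b∼c →
      join-elim A U≤⋁A a∼b λ i z az∼bz →
        join-elim B V≤⋁B (∼-∘ b∼c z) λ j z' bz∼cz →
          ∼-⊆ (AB⊆W i j) (·-intro (∼-∘ az∼bz z') bz∼cz)

    ⋆-of-join : ∀ {X} {I : Set ι} (F : I → Rel X) (J : Rel X) → Join F J →
      (T : Rel X) → IsReflTransClosure J T →
      (K : ℕ → Rel X) → (∀ n → Join (λ (is : Vec I n) → comp (map F is)) (K n)) →
      (U : Rel X) → Join K U →
      T ≅ U
    ⋆-of-join F J J-join T (J≤T , Δ≤T , TT≤T , T-least) K K-join U U-join =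
      ⊆⇒≤ T⊆U , ⊆⇒≤ U⊆T
      where
      open Join

      comp-F⊆U : ∀ {n} is → comp (map F is) ⊆ U
      comp-F⊆U {n} is = ⊆-trans (upper (K-join n) is) (upper U-join n)

      U⊆T : U ⊆ T
      U⊆T = least U-join T λ n → least (K-join n) T
              (comp-map-⊆ (≤⇒⊆ Δ≤T) (≤⇒⊆ TT≤T) λ i → ⊆-trans (upper J-join i) (≤⇒⊆ J≤T))

      U≤⋁K : U ≤⋁ λ (n : Lift ι ℕ) → K (lower n)
      U≤⋁K V K⊆V = least U-join V λ n → K⊆V (lift n)

      UU⊆U : U · U ⊆ U
      UU⊆U = ·-join U≤⋁K U≤⋁K λ { (lift n) (lift m) →
        ·-join (least (K-join n)) (least (K-join m)) λ is js →
          ⊆-trans (comp-map-++ F is js) (comp-F⊆U (is ++ js)) }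

      T⊆U : T ⊆ U
      T⊆U = ≤⇒⊆ (T-least U (⊆⇒≤ (least J-join U λ i → comp-F⊆U (i ∷ [])))
                             (⊆⇒≤ (comp-F⊆U [])) (⊆⇒≤ UU⊆U))

    ⋆-as-powers : ∀ {X} (R T : Rel X) → IsReflTransClosure R T →
                  (U : Rel X) → Join (pow R) U → T ≅ U
    ⋆-as-powers R T closure U U-join =
      ⋆-of-join (λ (_ : Lift ι ⊤) → R) R singleton-join T closure (pow R) pow-join U U-join
      where
      singleton-join : Join (λ (_ : Lift ι ⊤) → R) R
      singleton-join = record { upper = λ _ → ⊆-refl ; least = λ V R⊆V → R⊆V (lift tt) }

      ones : ∀ {n} → Vec (Lift ι ⊤) n
      ones = replicate _ (lift tt)

      pow-join : ∀ n → Join (λ (is : Vec (Lift ι ⊤) n) → comp (map (λ _ → R) is)) (pow R n)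
      pow-join n = record
        { upper = λ is → subst (λ Rs → comp Rs ⊆ pow R n) (sym (map-const is R)) ⊆-refl
        ; least = λ V Rⁿ⊆V → subst (λ Rs → comp Rs ⊆ V) (map-const (ones {n}) R) (Rⁿ⊆V ones)
        }

lemmaB3 : ∀ {o h ι : Level} (S : Setting o h ι) →
    MonoStableUnderFiniteCoproducts S → InfinitaryExtensive S →
    let open Setting S
        open Relations S
    in
    -- (1) R⋆ = ⋁_{n ≥ 0} Rⁿ
    (∀ (X : Obj) (R T U : Rel X) →
       IsReflTransClosure R T →
       IsJoin (λ P → Σ ℕ λ n → P ≡ pow R n) U →
       T ≅ U)
    ×
    -- (2) (⋁_{R ∈ ℛ} R)⋆ = ⋁_{n ≥ 0} ⋁_{R₁ … Rₙ ∈ ℛ} R₁ · ⋯ · Rₙ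
    (∀ (X : Obj) (I : Set ι) → I → (F : I → Rel X) →
       (J : Rel X) → IsJoin (λ P → Σ I λ i → P ≡ F i) J →
       (T : Rel X) → IsReflTransClosure J T →
       (K : ℕ → Rel X) →
       (∀ (n : ℕ) → IsJoin (λ P → Σ (Vec I n) λ is → P ≡ comp (map F is)) (K n)) →
       (U : Rel X) → IsJoin (λ P → Σ ℕ λ n → P ≡ K n) U →
       T ≅ U)
lemmaB3 S _ (_ , _ , essSurj) =
  (λ _ R T U closure U-join → ⋆-as-powers R T closure U (join U-join)) ,
  (λ _ _ _ F J J-join T closure K K-join U U-join →
     ⋆-of-join F J (join J-join) T closure K (λ n → join (K-join n)) U (join U-join))
  where
  open RelationCalculus S using (join)
  open RelationCalculus.Extensive S essSurj
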